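{- The order of promotion on increasing labelings of $\mathcal{Z}_4$ with labels in $[q]$ for $q \geq 4$ is $15q$.
   Context: $\mathcal{Z}_4$ is the zig-zag poset $x_1\lessdot x_2\gtrdot x_3\lessdot x_4$. Increasing labelings are $f:\mathcal{Z}_4\to[q]$ with $f(x)<f(y)$ whenever $x<y$. Promotion: replace labels $1$ by empty boxes; for $i=2,\dots,q$ slide boxes upward (a box at $x$ becomes $i$ if some $y\gtrdot x$ is labeled $i$, and that element becomes a box); replace boxes by $q+1$ and subtract $1$ from all labels. The order is the least $N$ with $\mathrm{Pro}^N$ the identity. -}

module Defs where

open import Data.Nat using (ℕ; zero; suc; _<_; _≤_; _∸_; _+_; _≡ᵇ_)
open import Data.Fin using (Fin; zero; suc)
open import Data.Bool using (Bool; true; false; if_then_else_; _∧_)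
open import Data.List using (List; []; _∷_; foldl; applyUpTo)
open import Data.Bool.ListAction using (any)
open import Data.Maybe using (Maybe; just; nothing; maybe)
open import Data.Product using (_×_)
open import Relation.Binary.PropositionalEquality using (_≡_)
open import Relation.Nullary using (¬_)

-- The zig-zag poset Z₄ : x₁ ⋖ x₂ ⋗ x₃ ⋖ x₄.
-- Element xᵢ is represented by the Fin 4 value i-1.
Z4 : Set
Z4 = Fin 4

x₁ x₂ x₃ x₄ : Z4
x₁ = zero
x₂ = suc zero
x₃ = suc (suc zero)
x₄ = suc (suc (suc zero))

-- The strict order of Z₄.  Its only relations are the three cover relations
-- (Z₄ has no chains of length 2), so this is already transitively closed.
data _<Z_ : Z4 → Z4 → Set where
  x₁<x₂ : x₁ <Z x₂
  x₃<x₂ : x₃ <Z x₂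
  x₃<x₄ : x₃ <Z x₄

upCovers : Z4 → List Z4
upCovers zero = x₂ ∷ []
upCovers (suc zero) = []
upCovers (suc (suc zero)) = x₂ ∷ x₄ ∷ []
upCovers (suc (suc (suc zero))) = []

downCovers : Z4 → List Z4
downCovers zero = []
downCovers (suc zero) = x₁ ∷ x₃ ∷ []
downCovers (suc (suc zero)) = []
downCovers (suc (suc (suc zero))) = x₃ ∷ []

Labeling : Set
Labeling = Z4 → ℕ

IncreasingLabeling : ℕ → Labeling → Set
IncreasingLabeling q f = (∀ x → 1 ≤ f x × f x ≤ q) × (∀ x y → x <Z y → f x < f y)

-- Intermediate states during promotion: nothing = empty box.
State : Set
State = Z4 → Maybe ℕ

isLabel : ℕ → Maybe ℕ → Bool
isLabel i (just a) = a ≡ᵇ i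
isLabel i nothing = false

isBox : Maybe ℕ → Bool
isBox nothing = true
isBox (just _) = false

slide : ℕ → State → State
slide i s x with s x
... | nothing = if any (λ y → isLabel i (s y)) (upCovers x) then just i else nothing
... | just a = if (a ≡ᵇ i) ∧ any (λ y → isBox (s y)) (downCovers x) then nothing else just a

-- Promotion with label bound q:
-- replace labels 1 by boxes; slide for i = 2,…,q; boxes become q+1; subtract 1.
pro : ℕ → Labeling → Labeling
pro q f x = maybe (λ a → a ∸ 1) q (final x)
  where
  start : State
  start y = if f y ≡ᵇ 1 then nothing else just (f y)
  final : State
  final = foldl (λ s i → slide i s) start (applyUpTo (2 +_) (q ∸ 1))

iter : ℕ → (Labeling → Labeling) → Labeling → Labeling
iter zero g f = f
iter (suc n) g f = g (iter n g f)

ProPowerIsId : ℕ → ℕ → Set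
ProPowerIsId q N = ∀ f → IncreasingLabeling q f → ∀ x → iter N (pro q) f x ≡ f x

IsPromotionOrder : ℕ → ℕ → Set
IsPromotionOrder q N = (0 < N) × ProPowerIsId q N × (∀ M → 0 < M → M < N → ¬ ProPowerIsId q M)

{-# OPTIONS --safe #-}
module Submission where

-- An increasing labeling is determined by its pattern (the relative order of
-- its four labels) and by the positions of its k distinct labels on the cycle
-- ℤ/q. A promotion step without a label 1 lowers every label by one. When the
-- smallest label is 1, the boxes slide along a path that depends only on the
-- pattern, so the labels again move down one place on the cycle (1 wrapping
-- round to q) and the pattern changes by a fixed permutation `wrap`. In q steps
-- each of the k labels wraps round exactly once, so Proᵠ keeps the positions
-- and acts as wrapᵏ on patterns. Now wrap³ is a 5-cycle on the five patterns
-- with three distinct labels and wrap⁴ has order 3 on the orbit of p1423, which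
-- gives period 15q; and (1,2,1,2) returns to itself only after multiples of q
-- steps, so no smaller period exists.

open import Defs
open import Data.Bool using (true; false; if_then_else_)
open import Data.Bool.Properties using (∧-zeroʳ)
open import Data.Empty using (⊥-elim)
open import Data.Fin using (Fin; zero; suc; fromℕ; #_)
open import Data.List using (foldl; applyUpTo)
open import Data.Maybe using (Maybe; just; nothing; maybe)
open import Data.Nat using (ℕ; zero; suc; _+_; _*_; _∸_; _≡ᵇ_; _≤_; _<_; z≤n; s≤s; z<s; s<s; _≟_)
open import Data.Nat.DivMod using (_/_; _%_; m≡m%n+[m/n]*n; m%n<n)
open import Data.Nat.GeneralisedArithmetic using (iterate)
open import Data.Nat.Properties
open import Data.Product using (_×_; _,_; Σ; proj₁; proj₂)
open import Data.Sum using (_⊎_; inj₁; inj₂)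
open import Data.Vec using (Vec; []; _∷_; _∷ʳ_; lookup; replicate)
open import Data.Vec.Relation.Unary.Linked using (Linked; [-]; _∷_)
open import Relation.Binary.Definitions using (tri<; tri≈; tri>)
open import Relation.Binary.PropositionalEquality
open import Relation.Nullary using (¬_)
open import Relation.Nullary.Decidable using (dec-true; dec-false)

private
  variable
    A B : Set
    k n : ℕ

Tuple : Set → Set
Tuple A = A × A × A × A

toFun : Tuple A → Z4 → A
toFun (a , b , c , d) zero = a
toFun (a , b , c , d) (suc zero) = b
toFun (a , b , c , d) (suc (suc zero)) = c
toFun (a , b , c , d) (suc (suc (suc zero))) = d

fromFun : (Z4 → A) → Tuple A
fromFun f = f x₁ , f x₂ , f x₃ , f x₄

mapᵗ : (A → B) → Tuple A → Tuple B
mapᵗ f (a , b , c , d) = f a , f b , f c , f d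

toFun-fromFun : ∀ (f : Z4 → A) x → toFun (fromFun f) x ≡ f x
toFun-fromFun f zero = refl
toFun-fromFun f (suc zero) = refl
toFun-fromFun f (suc (suc zero)) = refl
toFun-fromFun f (suc (suc (suc zero))) = refl

toFun-mapᵗ : ∀ (f : A → B) t x → toFun (mapᵗ f t) x ≡ f (toFun t x)
toFun-mapᵗ f t zero = refl
toFun-mapᵗ f t (suc zero) = refl
toFun-mapᵗ f t (suc (suc zero)) = refl
toFun-mapᵗ f t (suc (suc (suc zero))) = refl

fromFun-≗ : ∀ {f : Z4 → A} {t} → (∀ x → f x ≡ toFun t x) → fromFun f ≡ t
fromFun-≗ f≗t = cong₂ _,_ (f≗t x₁) (cong₂ _,_ (f≗t x₂) (cong₂ _,_ (f≗t x₃) (f≗t x₄)))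

mapᵗ-cong : ∀ {f g : A → B} → (∀ x → f x ≡ g x) → ∀ t → mapᵗ f t ≡ mapᵗ g t
mapᵗ-cong f≗g (a , b , c , d) = cong₂ _,_ (f≗g a) (cong₂ _,_ (f≗g b) (cong₂ _,_ (f≗g c) (f≗g d)))

Stateᵗ : Set
Stateᵗ = Tuple (Maybe ℕ)

slideᵗ : ℕ → Stateᵗ → Stateᵗ
slideᵗ i t = fromFun (slide i (toFun t))

slide-values : ∀ i s x → slide i s x ≡ slide i (toFun (fromFun s)) x
slide-values i s zero with s zero
... | nothing = refl
... | just _ = refl
slide-values i s (suc zero) with s (suc zero)
... | nothing = refl
... | just _ = refl
slide-values i s (suc (suc zero)) with s (suc (suc zero))
... | nothing = refl
... | just _ = refl
slide-values i s (suc (suc (suc zero))) with s (suc (suc (suc zero)))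
... | nothing = refl
... | just _ = refl

slide-≗ : ∀ i {s t} → (∀ x → s x ≡ toFun t x) → ∀ x → slide i s x ≡ toFun (slideᵗ i t) x
slide-≗ i {s} {t} s≗t x = begin
  slide i s x                    ≡⟨ slide-values i s x ⟩
  slide i (toFun (fromFun s)) x  ≡⟨ cong (λ u → slide i (toFun u) x) (fromFun-≗ s≗t) ⟩
  slide i (toFun t) x            ≡⟨ toFun-fromFun (slide i (toFun t)) x ⟨
  toFun (slideᵗ i t) x           ∎
  where open ≡-Reasoning

slides : ℕ → ℕ → Stateᵗ → Stateᵗ
slides k zero t = t
slides k (suc n) t = slides (suc k) n (slideᵗ k t)

foldl-slides : ∀ {f} k n {s t} → (∀ i → f i ≡ k + i) → (∀ x → s x ≡ toFun t x) →
               ∀ x → foldl (λ s i → slide i s) s (applyUpTo f n) x ≡ toFun (slides k n t) x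
foldl-slides k zero f≡k+ s≗t = s≗t
foldl-slides {f} k (suc n) {s} {t} f≡k+ s≗t =
  foldl-slides (suc k) n (λ i → trans (f≡k+ (suc i)) (+-suc k i)) first
  where
  first : ∀ x → slide (f 0) s x ≡ toFun (slideᵗ k t) x
  first rewrite f≡k+ 0 | +-identityʳ k = slide-≗ k s≗t

boxIfOne : ℕ → Maybe ℕ
boxIfOne n = if n ≡ᵇ 1 then nothing else just n

finish : ℕ → Maybe ℕ → ℕ
finish q = maybe (λ a → a ∸ 1) q

promoteᵗ : ℕ → Tuple ℕ → Tuple ℕ
promoteᵗ q v = mapᵗ (finish q) (slides 2 (q ∸ 1) (mapᵗ boxIfOne v))

pro-toFun : ∀ q {f v} → (∀ x → f x ≡ toFun v x) → ∀ x → pro q f x ≡ toFun (promoteᵗ q v) x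
pro-toFun q {f} {v} f≗v x = begin
  pro q f x
    ≡⟨ cong (finish q) (foldl-slides 2 (q ∸ 1) (λ _ → refl) start x) ⟩
  finish q (toFun (slides 2 (q ∸ 1) (mapᵗ boxIfOne v)) x)
    ≡⟨ toFun-mapᵗ (finish q) _ x ⟨
  toFun (promoteᵗ q v) x
    ∎
  where
  open ≡-Reasoning
  start : ∀ y → boxIfOne (f y) ≡ toFun (mapᵗ boxIfOne v) y
  start y = trans (cong boxIfOne (f≗v y)) (sym (toFun-mapᵗ boxIfOne v y))

≡ᵇ-refl : ∀ n → (n ≡ᵇ n) ≡ true
≡ᵇ-refl n = dec-true (n ≟ n) refl

≢⇒≡ᵇ-false : ∀ {m n} → m ≢ n → (m ≡ᵇ n) ≡ false
≢⇒≡ᵇ-false {m} {n} = dec-false (m ≟ n)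

Idle : ℕ → Stateᵗ → Set
Idle j (a , b , c , d) = (a ≡ nothing ⊎ c ≡ nothing → b ≢ just j) × (c ≡ nothing → d ≢ just j)

isLabel-≢ : ∀ {j} m → m ≢ just j → isLabel j m ≡ false
isLabel-≢ nothing _ = refl
isLabel-≢ (just a) a≢j = ≢⇒≡ᵇ-false (λ a≡j → a≢j (cong just a≡j))

slide-idle : ∀ j t → Idle j t → slideᵗ j t ≡ t
slide-idle j (a , b , c , d) (idle₂ , idle₄) =
  cong₂ _,_ (at₁ a b idle₂)
    (cong₂ _,_ (at₂ a b c idle₂) (cong₂ _,_ (at₃ b c d idle₂ idle₄) (at₄ c d idle₄)))
  where
  at₁ : ∀ a b → (a ≡ nothing ⊎ c ≡ nothing → b ≢ just j) → slide j (toFun (a , b , c , d)) x₁ ≡ a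
  at₁ nothing b idle rewrite isLabel-≢ b (idle (inj₁ refl)) = refl
  at₁ (just a) b _ rewrite ∧-zeroʳ (a ≡ᵇ j) = refl
  at₂ : ∀ a b c → (a ≡ nothing ⊎ c ≡ nothing → b ≢ just j) → slide j (toFun (a , b , c , d)) x₂ ≡ b
  at₂ a nothing c _ = refl
  at₂ nothing (just b) c idle rewrite isLabel-≢ (just b) (idle (inj₁ refl)) = refl
  at₂ (just a) (just b) nothing idle rewrite isLabel-≢ (just b) (idle (inj₂ refl)) = refl
  at₂ (just a) (just b) (just c) _ rewrite ∧-zeroʳ (b ≡ᵇ j) = refl
  at₃ : ∀ b c d → (a ≡ nothing ⊎ c ≡ nothing → b ≢ just j) → (c ≡ nothing → d ≢ just j) →
        slide j (toFun (a , b , c , d)) x₃ ≡ c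
  at₃ b nothing d idle idle′ rewrite isLabel-≢ b (idle (inj₂ refl)) | isLabel-≢ d (idle′ refl) = refl
  at₃ b (just c) d _ _ rewrite ∧-zeroʳ (c ≡ᵇ j) = refl
  at₄ : ∀ c d → (c ≡ nothing → d ≢ just j) → slide j (toFun (a , b , c , d)) x₄ ≡ d
  at₄ c nothing _ = refl
  at₄ nothing (just d) idle rewrite isLabel-≢ (just d) (idle refl) = refl
  at₄ (just c) (just d) _ rewrite ∧-zeroʳ (d ≡ᵇ j) = refl

just-≢ : ∀ {j l} → j < l → just l ≢ just j
just-≢ j<l refl = <-irrefl refl j<l

idle-below : ∀ {j a c l l′} → j < l → j < l′ → Idle j (a , just l , c , just l′)
idle-below j<l j<l′ = (λ _ → just-≢ j<l) , (λ _ → just-≢ j<l′)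

idle-filled : ∀ {j a b c d} → Idle j (just a , b , just c , d)
idle-filled = (λ { (inj₁ ()) ; (inj₂ ()) }) , λ ()

slides-idle : ∀ {t} → (∀ j → Idle j t) → ∀ k n → slides k n t ≡ t
slides-idle idle k zero = refl
slides-idle {t} idle k (suc n) rewrite slide-idle k t (idle k) = slides-idle idle (suc k) n

slides-skip : ∀ k m {n t} → (∀ j → j < k + m → Idle j t) → slides k (m + n) t ≡ slides (k + m) n t
slides-skip k zero {n} {t} _ = cong (λ k → slides k n t) (sym (+-identityʳ k))
slides-skip k (suc m) {n} {t} idle
  rewrite slide-idle k t (idle k (m<m+n k z<s)) | +-suc k m = slides-skip (suc k) m idle

promote-no-ones : ∀ q a b c d → promoteᵗ q (suc (suc a) , suc (suc b) , suc (suc c) , suc (suc d))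
                                ≡ (suc a , suc b , suc c , suc d)
promote-no-ones q a b c d = cong (mapᵗ (finish q)) (slides-idle (λ _ → idle-filled) 2 (q ∸ 1))

promote-event : ∀ q b v {t} → suc (suc b) ≤ q →
                (∀ j → j < suc (suc b) → Idle j (mapᵗ boxIfOne v)) →
                slideᵗ (suc (suc b)) (mapᵗ boxIfOne v) ≡ t → (∀ j → Idle j t) →
                promoteᵗ q v ≡ mapᵗ (finish q) t
promote-event q b v {t} b≤q before event after with m≤n⇒∃[o]m+o≡n b≤q
... | n , refl = cong (mapᵗ (finish q)) (begin
  slides 2 (suc (b + n)) t₀    ≡⟨ cong (λ m → slides 2 m t₀) (+-suc b n) ⟨
  slides 2 (b + suc n) t₀      ≡⟨ slides-skip 2 b before ⟩
  slides (2 + b) (suc n) t₀    ≡⟨ cong (slides (3 + b) n) event ⟩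
  slides (3 + b) n t           ≡⟨ slides-idle after (3 + b) n ⟩
  t                            ∎)
  where
  open ≡-Reasoning
  t₀ : Stateᵗ
  t₀ = mapᵗ boxIfOne v

-- promote-X↑Y: the boxes that start at the elements X labelled 1 end up at Y
promote-x₁↑x₂ : ∀ q b c d → suc (suc b) ≤ q →
                promoteᵗ q (1 , suc (suc b) , suc (suc c) , suc (suc d)) ≡ (suc b , q , suc c , suc d)
promote-x₁↑x₂ q b c d b≤q =
  promote-event q b (1 , suc (suc b) , suc (suc c) , suc (suc d)) b≤q
    (λ j j<b → (λ _ → just-≢ j<b) , λ ()) event (λ _ → idle-filled)
  where
  event : slideᵗ (suc (suc b)) (nothing , just (suc (suc b)) , just (suc (suc c)) , just (suc (suc d)))
          ≡ (just (suc (suc b)) , nothing , just (suc (suc c)) , just (suc (suc d)))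
  event rewrite ≡ᵇ-refl b | ∧-zeroʳ (c ≡ᵇ b) | ∧-zeroʳ (d ≡ᵇ b) = refl

promote-x₃↑x₂ : ∀ q a b d → b < d → suc (suc b) ≤ q →
                promoteᵗ q (suc (suc a) , suc (suc b) , 1 , suc (suc d)) ≡ (suc a , q , suc b , suc d)
promote-x₃↑x₂ q a b d b<d b≤q =
  promote-event q b (suc (suc a) , suc (suc b) , 1 , suc (suc d)) b≤q
    (λ j j<b → idle-below j<b (<-trans j<b (s<s (s<s b<d)))) event (λ _ → idle-filled)
  where
  event : slideᵗ (suc (suc b)) (just (suc (suc a)) , just (suc (suc b)) , nothing , just (suc (suc d)))
          ≡ (just (suc (suc a)) , nothing , just (suc (suc b)) , just (suc (suc d)))
  event rewrite ≡ᵇ-refl b | ∧-zeroʳ (a ≡ᵇ b) | ≢⇒≡ᵇ-false (>⇒≢ b<d) = refl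

promote-x₃↑x₄ : ∀ q a b d → d < b → suc (suc d) ≤ q →
                promoteᵗ q (suc (suc a) , suc (suc b) , 1 , suc (suc d)) ≡ (suc a , suc b , suc d , q)
promote-x₃↑x₄ q a b d d<b d≤q =
  promote-event q d (suc (suc a) , suc (suc b) , 1 , suc (suc d)) d≤q
    (λ j j<d → idle-below (<-trans j<d (s<s (s<s d<b))) j<d) event (λ _ → idle-filled)
  where
  event : slideᵗ (suc (suc d)) (just (suc (suc a)) , just (suc (suc b)) , nothing , just (suc (suc d)))
          ≡ (just (suc (suc a)) , just (suc (suc b)) , just (suc (suc d)) , nothing)
  event rewrite ≡ᵇ-refl d | ∧-zeroʳ (a ≡ᵇ d) | ≢⇒≡ᵇ-false (>⇒≢ d<b) = refl

promote-x₃↑x₂x₄ : ∀ q a b → suc (suc b) ≤ q →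
                  promoteᵗ q (suc (suc a) , suc (suc b) , 1 , suc (suc b)) ≡ (suc a , q , suc b , q)
promote-x₃↑x₂x₄ q a b b≤q =
  promote-event q b (suc (suc a) , suc (suc b) , 1 , suc (suc b)) b≤q
    (λ j j<b → idle-below j<b j<b) event (λ _ → idle-filled)
  where
  event : slideᵗ (suc (suc b)) (just (suc (suc a)) , just (suc (suc b)) , nothing , just (suc (suc b)))
          ≡ (just (suc (suc a)) , nothing , just (suc (suc b)) , nothing)
  event rewrite ≡ᵇ-refl b | ∧-zeroʳ (a ≡ᵇ b) = refl

promote-x₁x₃↑x₂ : ∀ q b d → b < d → suc (suc b) ≤ q →
                  promoteᵗ q (1 , suc (suc b) , 1 , suc (suc d)) ≡ (suc b , q , suc b , suc d)
promote-x₁x₃↑x₂ q b d b<d b≤q =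
  promote-event q b (1 , suc (suc b) , 1 , suc (suc d)) b≤q
    (λ j j<b → idle-below j<b (<-trans j<b (s<s (s<s b<d)))) event (λ _ → idle-filled)
  where
  event : slideᵗ (suc (suc b)) (nothing , just (suc (suc b)) , nothing , just (suc (suc d)))
          ≡ (just (suc (suc b)) , nothing , just (suc (suc b)) , just (suc (suc d)))
  event rewrite ≡ᵇ-refl b | ≢⇒≡ᵇ-false (>⇒≢ b<d) = refl

promote-x₁x₃↑x₂x₄ : ∀ q b → suc (suc b) ≤ q →
                    promoteᵗ q (1 , suc (suc b) , 1 , suc (suc b)) ≡ (suc b , q , suc b , q)
promote-x₁x₃↑x₂x₄ q b b≤q =
  promote-event q b (1 , suc (suc b) , 1 , suc (suc b)) b≤q
    (λ j j<b → idle-below j<b j<b) event (λ _ → idle-filled)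
  where
  event : slideᵗ (suc (suc b)) (nothing , just (suc (suc b)) , nothing , just (suc (suc b)))
          ≡ (just (suc (suc b)) , nothing , just (suc (suc b)) , nothing)
  event rewrite ≡ᵇ-refl b = refl

promote-x₃↑x₄-x₁↑x₂ : ∀ q b d → d < b → suc (suc b) ≤ q →
                      promoteᵗ q (1 , suc (suc b) , 1 , suc (suc d)) ≡ (suc b , q , suc d , q)
promote-x₃↑x₄-x₁↑x₂ q b d d<b b≤q with m≤n⇒∃[o]m+o≡n d<b | m≤n⇒∃[o]m+o≡n b≤q
... | o , refl | n , refl = cong (mapᵗ (finish _)) (begin
  slides 2 (suc (suc (d + o + n))) t₀  ≡⟨ cong (λ m → slides 2 m t₀) count ⟩
  slides 2 (d + suc (o + suc n)) t₀    ≡⟨ slides-skip 2 d (λ _ j<d → idle-below (<-trans j<d d′<b′) j<d) ⟩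
  slides (2 + d) (suc (o + suc n)) t₀  ≡⟨ cong (slides (3 + d) (o + suc n)) event₁ ⟩
  slides (3 + d) (o + suc n) t₁        ≡⟨ slides-skip (3 + d) o (λ _ j<b → (λ _ → just-≢ j<b) , λ ()) ⟩
  slides (3 + d + o) (suc n) t₁        ≡⟨ cong (slides (4 + d + o) n) event₂ ⟩
  slides (4 + d + o) n t₂              ≡⟨ slides-idle (λ _ → idle-filled) (4 + d + o) n ⟩
  t₂                                   ∎)
  where
  open ≡-Reasoning
  b′ d′ : ℕ
  b′ = suc (suc (suc (d + o)))
  d′ = suc (suc d)
  d′<b′ : d′ < b′
  d′<b′ = s<s (s<s d<b)
  t₀ t₁ t₂ : Stateᵗ
  t₀ = nothing , just b′ , nothing , just d′
  t₁ = nothing , just b′ , just d′ , nothing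
  t₂ = just b′ , nothing , just d′ , nothing
  count : suc (suc (d + o + n)) ≡ d + suc (o + suc n)
  count = begin
    suc (suc (d + o + n))    ≡⟨ cong (λ m → suc (suc m)) (+-assoc d o n) ⟩
    suc (suc (d + (o + n)))  ≡⟨ cong suc (+-suc d (o + n)) ⟨
    suc (d + suc (o + n))    ≡⟨ cong (λ m → suc (d + m)) (+-suc o n) ⟨
    suc (d + (o + suc n))    ≡⟨ +-suc d (o + suc n) ⟨
    d + suc (o + suc n)      ∎
  event₁ : slideᵗ d′ t₀ ≡ t₁
  event₁ rewrite ≡ᵇ-refl d | ≢⇒≡ᵇ-false (>⇒≢ d<b) = refl
  event₂ : slideᵗ b′ t₁ ≡ t₂
  event₂ rewrite ≡ᵇ-refl (d + o) | ∧-zeroʳ (d ≡ᵇ suc (d + o)) = refl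

-- Configurations: a pattern and the gaps between the distinct labels

-- pabcd: the labels of x₁, x₂, x₃, x₄ are the a-th, b-th, c-th, d-th smallest
data Pattern : ℕ → Set where
  p1212 : Pattern 2
  p1213 p1312 p1323 p2312 p2313 : Pattern 3
  p1324 p2413 p1423 p3412 p2314 : Pattern 4

ranks : Pattern k → Tuple (Fin k)
ranks p1212 = # 0 , # 1 , # 0 , # 1
ranks p1213 = # 0 , # 1 , # 0 , # 2
ranks p1312 = # 0 , # 2 , # 0 , # 1
ranks p1323 = # 0 , # 2 , # 1 , # 2
ranks p2312 = # 1 , # 2 , # 0 , # 1
ranks p2313 = # 1 , # 2 , # 0 , # 2
ranks p1324 = # 0 , # 2 , # 1 , # 3
ranks p2413 = # 1 , # 3 , # 0 , # 2
ranks p1423 = # 0 , # 3 , # 1 , # 2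
ranks p3412 = # 2 , # 3 , # 0 , # 1
ranks p2314 = # 1 , # 2 , # 0 , # 3

-- the new pattern when promotion moves the label 1 round to q (see promote-wrap)
wrap : Pattern k → Pattern k
wrap p1212 = p1212
wrap p1213 = p1312
wrap p1312 = p2313
wrap p2313 = p1323
wrap p1323 = p2312
wrap p2312 = p1213
wrap p1324 = p2413
wrap p2413 = p1324
wrap p1423 = p3412
wrap p3412 = p2314
wrap p2314 = p1423

-- distinct labels v₁ < ⋯ < vₖ ≤ q: the gaps are vᵢ - vᵢ₋₁ - 1 (with v₀ = 0), the slack is q - vₖ
record Config (k : ℕ) : Set where
  constructor ⟨_,_,_⟩
  field
    shape : Pattern k
    gaps  : Vec ℕ k
    slack : ℕ

position : Vec ℕ n → Fin (suc n) → ℕ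
position gs zero = 0
position (g ∷ gs) (suc i) = suc g + position gs i

span : Vec ℕ n → ℕ → ℕ
span [] b = b
span (g ∷ gs) b = suc g + span gs b

labels : Config k → Tuple ℕ
labels ⟨ p , gs , _ ⟩ = mapᵗ (λ i → position gs (suc i)) (ranks p)

bound : Config k → ℕ
bound ⟨ _ , gs , b ⟩ = span gs b

step : Config k → Config k
step ⟨ p , suc a ∷ gs , b ⟩ = ⟨ p , a ∷ gs , suc b ⟩
step ⟨ p , zero ∷ gs , b ⟩ = ⟨ wrap p , gs ∷ʳ b , 0 ⟩
step ⟨ () , [] , _ ⟩

span-suc : ∀ (gs : Vec ℕ n) b → span gs (suc b) ≡ suc (span gs b)
span-suc [] b = refl
span-suc (g ∷ gs) b = trans (cong (suc g +_) (span-suc gs b)) (+-suc (suc g) (span gs b))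

span-∷ʳ : ∀ (gs : Vec ℕ n) x b → span (gs ∷ʳ x) b ≡ span gs (suc x + b)
span-∷ʳ [] x b = refl
span-∷ʳ (g ∷ gs) x b = cong (suc g +_) (span-∷ʳ gs x b)

position-last : ∀ (gs : Vec ℕ n) b → position (gs ∷ʳ b) (fromℕ (suc n)) ≡ suc (span gs b)
position-last [] b = +-identityʳ (suc b)
position-last (g ∷ gs) b = trans (cong (suc g +_) (position-last gs b)) (+-suc (suc g) (span gs b))

bound-step : (c : Config k) → bound (step c) ≡ bound c
bound-step ⟨ p , suc a ∷ gs , b ⟩ = trans (cong (suc a +_) (span-suc gs b)) (+-suc (suc a) (span gs b))
bound-step ⟨ p , zero ∷ gs , b ⟩ =
  trans (span-∷ʳ gs b 0) (trans (cong (span gs) (+-identityʳ (suc b))) (span-suc gs b))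

<-+suc : ∀ g {x y} → x ≤ y → g + x < g + suc y
<-+suc g x≤y = +-monoʳ-< g (s≤s x≤y)

-- q is written as the new largest label, so that both sides compute to 4-tuples
promote-wrap : (p : Pattern (suc n)) (gs : Vec ℕ n) (b : ℕ) →
               promoteᵗ (position (gs ∷ʳ b) (fromℕ (suc n))) (labels ⟨ p , 0 ∷ gs , b ⟩)
               ≡ labels ⟨ wrap p , gs ∷ʳ b , 0 ⟩
promote-wrap p1212 (g ∷ []) b = promote-x₁x₃↑x₂x₄ _ _ (s≤s (<-+suc g z≤n))
promote-wrap p1213 (g ∷ h ∷ []) b = promote-x₁x₃↑x₂ _ _ _ (<-+suc g z≤n) (s≤s (<-+suc g z≤n))
promote-wrap p1312 (g ∷ h ∷ []) b =
  promote-x₃↑x₄-x₁↑x₂ _ _ _ (<-+suc g z≤n) (s≤s (<-+suc g (<-+suc h z≤n)))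
promote-wrap p1323 (g ∷ h ∷ []) b = promote-x₁↑x₂ _ _ _ _ (s≤s (<-+suc g (<-+suc h z≤n)))
promote-wrap p2312 (g ∷ h ∷ []) b = promote-x₃↑x₄ _ _ _ _ (<-+suc g z≤n) (s≤s (<-+suc g z≤n))
promote-wrap p2313 (g ∷ h ∷ []) b = promote-x₃↑x₂x₄ _ _ _ (s≤s (<-+suc g (<-+suc h z≤n)))
promote-wrap p1324 (g ∷ h ∷ i ∷ []) b = promote-x₁↑x₂ _ _ _ _ (s≤s (<-+suc g (<-+suc h z≤n)))
promote-wrap p2413 (g ∷ h ∷ i ∷ []) b =
  promote-x₃↑x₄ _ _ _ _ (<-+suc g (<-+suc h z≤n)) (s≤s (<-+suc g (<-+suc h z≤n)))
promote-wrap p1423 (g ∷ h ∷ i ∷ []) b = promote-x₁↑x₂ _ _ _ _ (s≤s (<-+suc g (<-+suc h (<-+suc i z≤n))))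
promote-wrap p3412 (g ∷ h ∷ i ∷ []) b = promote-x₃↑x₄ _ _ _ _ (<-+suc g z≤n) (s≤s (<-+suc g z≤n))
promote-wrap p2314 (g ∷ h ∷ i ∷ []) b =
  promote-x₃↑x₂ _ _ _ _ (<-+suc g (<-+suc h z≤n)) (s≤s (<-+suc g (<-+suc h z≤n)))

promote-labels : (c : Config k) → promoteᵗ (bound c) (labels c) ≡ labels (step c)
promote-labels c@(⟨ p , suc a ∷ gs , b ⟩) = promote-no-ones (bound c) _ _ _ _
promote-labels ⟨ p , zero ∷ gs , b ⟩ =
  subst (λ q → promoteᵗ q (labels ⟨ p , 0 ∷ gs , b ⟩) ≡ labels ⟨ wrap p , gs ∷ʳ b , 0 ⟩)
        (position-last gs b) (promote-wrap p gs b)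

iterate-+ : ∀ (f : A → A) x m n → iterate f x (m + n) ≡ iterate f (iterate f x m) n
iterate-+ f x zero n = refl
iterate-+ f x (suc m) n = iterate-+ f (f x) m n

iterate-suc : ∀ (f : A → A) x n → iterate f x (suc n) ≡ f (iterate f x n)
iterate-suc f x zero = refl
iterate-suc f x (suc n) = iterate-suc f (f x) n

bound-iterate : ∀ (c : Config k) n → bound (iterate step c n) ≡ bound c
bound-iterate c zero = refl
bound-iterate c (suc n) = trans (bound-iterate (step c) n) (bound-step c)

iter-pro : ∀ (c : Config k) {f} → (∀ x → f x ≡ toFun (labels c) x) →
           ∀ n x → iter n (pro (bound c)) f x ≡ toFun (labels (iterate step c n)) x
iter-pro c f≗c zero x = f≗c x
iter-pro {k} c {f} f≗c (suc n) x = begin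
  pro (bound c) (iter n (pro (bound c)) f) x
    ≡⟨ pro-toFun (bound c) (iter-pro c f≗c n) x ⟩
  toFun (promoteᵗ (bound c) (labels cₙ)) x
    ≡⟨ cong (λ q → toFun (promoteᵗ q (labels cₙ)) x) (bound-iterate c n) ⟨
  toFun (promoteᵗ (bound cₙ) (labels cₙ)) x
    ≡⟨ cong (λ v → toFun v x) (promote-labels cₙ) ⟩
  toFun (labels (step cₙ)) x
    ≡⟨ cong (λ c → toFun (labels c) x) (iterate-suc step c n) ⟨
  toFun (labels (iterate step c (suc n))) x
    ∎
  where
  open ≡-Reasoning
  cₙ : Config k
  cₙ = iterate step c n

shift-steps : ∀ (p : Pattern (suc n)) a x gs b →
              iterate step ⟨ p , (a + x) ∷ gs , b ⟩ a ≡ ⟨ p , x ∷ gs , b + a ⟩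
shift-steps p zero x gs b = cong ⟨ p , x ∷ gs ,_⟩ (sym (+-identityʳ b))
shift-steps p (suc a) x gs b =
  trans (shift-steps p a x gs (suc b)) (cong ⟨ p , x ∷ gs ,_⟩ (sym (+-suc b a)))

wrap-steps : ∀ (p : Pattern (suc n)) x gs b →
             iterate step ⟨ p , x ∷ gs , b ⟩ (suc x) ≡ ⟨ wrap p , gs ∷ʳ (b + x) , 0 ⟩
wrap-steps p zero gs b = cong (λ g → ⟨ wrap p , gs ∷ʳ g , 0 ⟩) (sym (+-identityʳ b))
wrap-steps p (suc x) gs b =
  trans (wrap-steps p x gs (suc b)) (cong (λ g → ⟨ wrap p , gs ∷ʳ g , 0 ⟩) (sym (+-suc b x)))

wrap-steps-+ : ∀ (p : Pattern (suc n)) x gs b m →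
               iterate step ⟨ p , x ∷ gs , b ⟩ (suc x + m) ≡ iterate step ⟨ wrap p , gs ∷ʳ (b + x) , 0 ⟩ m
wrap-steps-+ p x gs b m =
  trans (iterate-+ step _ (suc x) m) (cong (λ c → iterate step c m) (wrap-steps p x gs b))

-- in q steps each of the k labels wraps round exactly once
steps-bound : (c : Config k) → let open Config c in
              iterate step c (bound c) ≡ ⟨ iterate wrap shape k , gaps , slack ⟩
steps-bound ⟨ p , g ∷ h ∷ [] , b ⟩ =
  trans (wrap-steps-+ p g _ b _) (trans (wrap-steps-+ _ h _ 0 _) (shift-steps _ b g _ 0))
steps-bound ⟨ p , g ∷ h ∷ i ∷ [] , b ⟩ =
  trans (wrap-steps-+ p g _ b _) (trans (wrap-steps-+ _ h _ 0 _) (trans (wrap-steps-+ _ i _ 0 _)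
    (shift-steps _ b g _ 0)))
steps-bound ⟨ p , g ∷ h ∷ i ∷ j ∷ [] , b ⟩ =
  trans (wrap-steps-+ p g _ b _) (trans (wrap-steps-+ _ h _ 0 _) (trans (wrap-steps-+ _ i _ 0 _)
    (trans (wrap-steps-+ _ j _ 0 _) (shift-steps _ b g _ 0))))
steps-bound ⟨ () , [] , _ ⟩
steps-bound ⟨ () , _ ∷ [] , _ ⟩
steps-bound ⟨ () , _ ∷ _ ∷ _ ∷ _ ∷ _ ∷ _ , _ ⟩

steps-*bound : ∀ m (c : Config k) → let open Config c in
               iterate step c (m * bound c) ≡ ⟨ iterate wrap shape (m * k) , gaps , slack ⟩
steps-*bound zero c = refl
steps-*bound {k} (suc m) c@(⟨ p , gs , b ⟩) = begin
  iterate step c (bound c + m * bound c)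
    ≡⟨ iterate-+ step c (bound c) (m * bound c) ⟩
  iterate step (iterate step c (bound c)) (m * bound c)
    ≡⟨ cong (λ c′ → iterate step c′ (m * bound c)) (steps-bound c) ⟩
  iterate step ⟨ iterate wrap p k , gs , b ⟩ (m * bound c)
    ≡⟨ steps-*bound m ⟨ iterate wrap p k , gs , b ⟩ ⟩
  ⟨ iterate wrap (iterate wrap p k) (m * k) , gs , b ⟩
    ≡⟨ cong ⟨_, gs , b ⟩ (iterate-+ wrap p k (m * k)) ⟨
  ⟨ iterate wrap p (k + m * k) , gs , b ⟩
    ∎
  where open ≡-Reasoning

wrap-period : (p : Pattern k) → iterate wrap p (15 * k) ≡ p
wrap-period p1212 = refl
wrap-period p1213 = refl
wrap-period p1312 = refl
wrap-period p1323 = refl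
wrap-period p2312 = refl
wrap-period p2313 = refl
wrap-period p1324 = refl
wrap-period p2413 = refl
wrap-period p1423 = refl
wrap-period p3412 = refl
wrap-period p2314 = refl

-- Every increasing labeling is given by a configuration

+-suc-assoc : ∀ l g x → l + (suc g + x) ≡ suc l + g + x
+-suc-assoc l g x = trans (sym (+-assoc l (suc g) x)) (cong (_+ x) (+-suc l g))

chain-gaps : ∀ {hi} lo (ws : Vec ℕ n) → Linked _<_ (lo ∷ (ws ∷ʳ suc hi)) →
             Σ (Vec ℕ n) λ gs → Σ ℕ λ b →
             (∀ i → lo + position gs (suc i) ≡ lookup ws i) × lo + span gs b ≡ hi
chain-gaps lo [] (lo<hi ∷ [-]) = [] , _ , (λ ()) , m+[n∸m]≡n (≤-pred lo<hi)
chain-gaps lo (w ∷ ws) (lo<w ∷ chain) with chain-gaps w ws chain | m≤n⇒∃[o]m+o≡n lo<w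
... | gs , b , marks , total | g , refl =
  g ∷ gs , b , marks′ , trans (+-suc-assoc lo g (span gs b)) total
  where
  marks′ : ∀ i → lo + position (g ∷ gs) (suc i) ≡ lookup (suc lo + g ∷ ws) i
  marks′ zero = trans (+-suc-assoc lo g 0) (+-identityʳ _)
  marks′ (suc i) = trans (+-suc-assoc lo g _) (marks i)

Represented : ℕ → Tuple ℕ → Set
Represented q v = Σ ℕ λ k → Σ (Config k) λ c → bound c ≡ q × labels c ≡ v

represent-chain : ∀ {q v} (p : Pattern k) (ws : Vec ℕ k) → Linked _<_ (0 ∷ (ws ∷ʳ suc q)) →
                  mapᵗ (lookup ws) (ranks p) ≡ v → Represented q v
represent-chain {k} p ws chain refl with chain-gaps 0 ws chain
... | gs , b , marks , total = k , ⟨ p , gs , b ⟩ , total , mapᵗ-cong marks (ranks p)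

represent : ∀ {q a b c d} → 0 < a → 0 < c → b ≤ q → d ≤ q → a < b → c < b → c < d →
            Represented q (a , b , c , d)
represent {a = a} {b} {c} {d} 0<a 0<c b≤q d≤q a<b c<b c<d with <-cmp a c | <-cmp b d | <-cmp a d
... | tri≈ _ refl _ | tri< b<d _ _ | _ =
  represent-chain p1213 (a ∷ b ∷ d ∷ []) (0<a ∷ a<b ∷ b<d ∷ s≤s d≤q ∷ [-]) refl
... | tri≈ _ refl _ | tri≈ _ refl _ | _ =
  represent-chain p1212 (a ∷ b ∷ []) (0<a ∷ a<b ∷ s≤s b≤q ∷ [-]) refl
... | tri≈ _ refl _ | tri> _ _ d<b | _ =
  represent-chain p1312 (a ∷ d ∷ b ∷ []) (0<a ∷ c<d ∷ d<b ∷ s≤s b≤q ∷ [-]) refl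
... | tri< a<c _ _ | tri< b<d _ _ | _ =
  represent-chain p1324 (a ∷ c ∷ b ∷ d ∷ []) (0<a ∷ a<c ∷ c<b ∷ b<d ∷ s≤s d≤q ∷ [-]) refl
... | tri< a<c _ _ | tri≈ _ refl _ | _ =
  represent-chain p1323 (a ∷ c ∷ b ∷ []) (0<a ∷ a<c ∷ c<b ∷ s≤s b≤q ∷ [-]) refl
... | tri< a<c _ _ | tri> _ _ d<b | _ =
  represent-chain p1423 (a ∷ c ∷ d ∷ b ∷ []) (0<a ∷ a<c ∷ c<d ∷ d<b ∷ s≤s b≤q ∷ [-]) refl
... | tri> _ _ c<a | _ | tri> _ _ d<a =
  represent-chain p3412 (c ∷ d ∷ a ∷ b ∷ []) (0<c ∷ c<d ∷ d<a ∷ a<b ∷ s≤s b≤q ∷ [-]) refl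
... | tri> _ _ c<a | _ | tri≈ _ refl _ =
  represent-chain p2312 (c ∷ a ∷ b ∷ []) (0<c ∷ c<a ∷ a<b ∷ s≤s b≤q ∷ [-]) refl
... | tri> _ _ c<a | tri> _ _ d<b | tri< a<d _ _ =
  represent-chain p2413 (c ∷ a ∷ d ∷ b ∷ []) (0<c ∷ c<a ∷ a<d ∷ d<b ∷ s≤s b≤q ∷ [-]) refl
... | tri> _ _ c<a | tri≈ _ refl _ | tri< a<d _ _ =
  represent-chain p2313 (c ∷ a ∷ b ∷ []) (0<c ∷ c<a ∷ a<b ∷ s≤s b≤q ∷ [-]) refl
... | tri> _ _ c<a | tri< b<d _ _ | tri< a<d _ _ =
  represent-chain p2314 (c ∷ a ∷ b ∷ d ∷ []) (0<c ∷ c<a ∷ a<b ∷ b<d ∷ s≤s d≤q ∷ [-]) refl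

represent-labeling : ∀ {q f} → IncreasingLabeling q f → Represented q (fromFun f)
represent-labeling (range , mono) =
  represent (proj₁ (range x₁)) (proj₁ (range x₃)) (proj₂ (range x₂)) (proj₂ (range x₄))
            (mono x₁ x₂ x₁<x₂) (mono x₃ x₂ x₃<x₂) (mono x₃ x₄ x₃<x₄)

promotion-period : ∀ q → ProPowerIsId q (15 * q)
promotion-period q f inc x with represent-labeling inc
... | k , c@(⟨ p , gs , b ⟩) , refl , c≡f = begin
  iter (15 * bound c) (pro (bound c)) f x
    ≡⟨ iter-pro c f≗c (15 * bound c) x ⟩
  toFun (labels (iterate step c (15 * bound c))) x
    ≡⟨ cong (λ c → toFun (labels c) x) (steps-*bound 15 c) ⟩
  toFun (labels ⟨ iterate wrap p (15 * k) , gs , b ⟩) x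
    ≡⟨ cong (λ p → toFun (labels ⟨ p , gs , b ⟩) x) (wrap-period p) ⟩
  toFun (labels c) x
    ≡⟨ f≗c x ⟨
  f x
    ∎
  where
  open ≡-Reasoning
  f≗c : ∀ x → f x ≡ toFun (labels c) x
  f≗c x = trans (sym (toFun-fromFun f x)) (cong (λ v → toFun v x) (sym c≡f))

-- No smaller period

increasing-tuple : ∀ {q a b c d} → 0 < a → 0 < c → b ≤ q → d ≤ q → a < b → c < b → c < d →
                   IncreasingLabeling q (toFun (a , b , c , d))
increasing-tuple 0<a 0<c b≤q d≤q a<b c<b c<d =
  (λ { zero → 0<a , ≤-trans (<⇒≤ a<b) b≤q
     ; (suc zero) → <-trans 0<a a<b , b≤q
     ; (suc (suc zero)) → 0<c , ≤-trans (<⇒≤ c<b) b≤q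
     ; (suc (suc (suc zero))) → <-trans 0<c c<d , d≤q }) ,
  λ { _ _ x₁<x₂ → a<b ; _ _ x₃<x₂ → c<b ; _ _ x₃<x₄ → c<d }

labels-fixed : ∀ {q} M → ProPowerIsId q M → (c : Config k) → bound c ≡ q →
               IncreasingLabeling q (toFun (labels c)) → labels (iterate step c M) ≡ labels c
labels-fixed M isId c refl inc =
  fromFun-≗ (λ x → trans (sym (iter-pro c (λ _ → refl) M x)) (isId (toFun (labels c)) inc x))

standard : Pattern k → Tuple ℕ
standard {k} p = labels ⟨ p , replicate k 0 , 0 ⟩

wrap-powers-move : ∀ m → 0 < m → m < 15 →
                   standard (iterate wrap p1213 (m * 3)) ≢ standard p1213 ⊎
                   standard (iterate wrap p1423 (m * 4)) ≢ standard p1423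
wrap-powers-move 1 _ _ = inj₁ λ ()
wrap-powers-move 2 _ _ = inj₁ λ ()
wrap-powers-move 3 _ _ = inj₁ λ ()
wrap-powers-move 4 _ _ = inj₁ λ ()
wrap-powers-move 5 _ _ = inj₂ λ ()
wrap-powers-move 6 _ _ = inj₁ λ ()
wrap-powers-move 7 _ _ = inj₁ λ ()
wrap-powers-move 8 _ _ = inj₁ λ ()
wrap-powers-move 9 _ _ = inj₁ λ ()
wrap-powers-move 10 _ _ = inj₂ λ ()
wrap-powers-move 11 _ _ = inj₁ λ ()
wrap-powers-move 12 _ _ = inj₁ λ ()
wrap-powers-move 13 _ _ = inj₁ λ ()
wrap-powers-move 14 _ _ = inj₁ λ ()
wrap-powers-move (suc (suc (suc (suc (suc (suc (suc (suc (suc (suc (suc (suc (suc (suc (suc m))))))))))))))) _ m<15 =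
  ⊥-elim (<⇒≱ m<15 (m≤m+n 15 m))

iterate-wrap-p1212 : ∀ j → iterate wrap p1212 j ≡ p1212
iterate-wrap-p1212 zero = refl
iterate-wrap-p1212 (suc j) = iterate-wrap-p1212 j

no-early-return : ∀ B r → 0 < r → r < 3 + B →
                  labels (iterate step ⟨ p1212 , replicate 2 0 , suc B ⟩ r) ≢ standard p1212
-- one step gives (1, q, 1, q); after 2 + s steps the label of x₁ is q - 1 - s
no-early-return B 1 _ _ ()
no-early-return B (suc (suc s)) _ (s≤s (s≤s (s≤s s≤B))) with m≤n⇒∃[o]m+o≡n s≤B
... | x , refl = λ returned → still-moving (trans (sym (cong labels moved)) returned)
  where
  moved : iterate step ⟨ p1212 , suc (s + x) ∷ 0 ∷ [] , 0 ⟩ s ≡ ⟨ p1212 , suc x ∷ 0 ∷ [] , s ⟩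
  moved = trans (cong (λ g → iterate step ⟨ p1212 , g ∷ 0 ∷ [] , 0 ⟩ s) (sym (+-suc s x)))
                (shift-steps p1212 s (suc x) (0 ∷ []) 0)
  still-moving : labels ⟨ p1212 , suc x ∷ 0 ∷ [] , s ⟩ ≢ standard p1212
  still-moving ()

period-divisible : ∀ n M → ProPowerIsId (4 + n) M → M ≡ M / (4 + n) * (4 + n)
period-divisible n M isId with M % (4 + n) | m≡m%n+[m/n]*n M (4 + n) | m%n<n M (4 + n)
... | zero  | M≡ | _   = M≡
... | suc r | M≡ | r<q = ⊥-elim (no-early-return (suc n) (suc r) z<s r<q returned)
  where
  open ≡-Reasoning
  q m : ℕ
  q = 4 + n
  m = M / q
  c₂ : Config 2
  c₂ = ⟨ p1212 , replicate 2 0 , 2 + n ⟩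
  c₂-periodic : iterate step c₂ (m * q) ≡ c₂
  c₂-periodic = trans (steps-*bound m c₂) (cong ⟨_, replicate 2 0 , 2 + n ⟩ (iterate-wrap-p1212 (m * 2)))
  inc₂ : IncreasingLabeling q (toFun (standard p1212))
  inc₂ = increasing-tuple z<s z<s (m≤m+n 2 (2 + n)) (m≤m+n 2 (2 + n)) (s<s z<s) (s<s z<s) (s<s z<s)
  returned : labels (iterate step c₂ (suc r)) ≡ standard p1212
  returned = begin
    labels (iterate step c₂ (suc r))
      ≡⟨ cong (λ c → labels (iterate step c (suc r))) c₂-periodic ⟨
    labels (iterate step (iterate step c₂ (m * q)) (suc r))
      ≡⟨ cong labels (iterate-+ step c₂ (m * q) (suc r)) ⟨
    labels (iterate step c₂ (m * q + suc r))
      ≡⟨ cong (λ j → labels (iterate step c₂ j)) (trans (+-comm (m * q) (suc r)) (sym M≡)) ⟩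
    labels (iterate step c₂ M)
      ≡⟨ labels-fixed M isId c₂ refl inc₂ ⟩
    standard p1212
      ∎

not-period-multiple : ∀ n m → 0 < m → m < 15 → ¬ ProPowerIsId (4 + n) (m * (4 + n))
not-period-multiple n m 0<m m<15 isId with wrap-powers-move m 0<m m<15
... | inj₁ moves =
  moves (trans (cong labels (sym (steps-*bound m c₃))) (labels-fixed (m * (4 + n)) isId c₃ refl inc₃))
  where
  c₃ : Config 3
  c₃ = ⟨ p1213 , replicate 3 0 , 1 + n ⟩
  inc₃ : IncreasingLabeling (4 + n) (toFun (standard p1213))
  inc₃ = increasing-tuple z<s z<s (m≤m+n 2 (2 + n)) (m≤m+n 3 (1 + n)) (s<s z<s) (s<s z<s) (s<s z<s)
... | inj₂ moves =
  moves (trans (cong labels (sym (steps-*bound m c₄))) (labels-fixed (m * (4 + n)) isId c₄ refl inc₄))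
  where
  c₄ : Config 4
  c₄ = ⟨ p1423 , replicate 4 0 , n ⟩
  inc₄ : IncreasingLabeling (4 + n) (toFun (standard p1423))
  inc₄ = increasing-tuple z<s z<s (m≤m+n 4 n) (m≤m+n 3 (1 + n)) (s<s z<s) (s<s (s<s z<s)) (s<s (s<s z<s))

not-period : ∀ n M → 0 < M → M < 15 * (4 + n) → ¬ ProPowerIsId (4 + n) M
not-period n M 0<M M<15q isId with M / (4 + n) | period-divisible n M isId
... | zero  | M≡0  = <-irrefl (sym M≡0) 0<M
... | suc m | refl = not-period-multiple n (suc m) z<s (*-cancelʳ-< (4 + n) (suc m) 15 M<15q) isId

promotion-order : ∀ n → IsPromotionOrder (4 + n) (15 * (4 + n))
promotion-order n = z<s , promotion-period (4 + n) , not-period n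

corollary4p3 : ∀ q → 4 ≤ q → IsPromotionOrder q (15 * q)
corollary4p3 q 4≤q = let n , 4+n≡q = m≤n⇒∃[o]m+o≡n 4≤q in
  subst (λ q → IsPromotionOrder q (15 * q)) 4+n≡q (promotion-order n)
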